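{- Let $G=(V,E)$ be a connected, undirected, unweighted graph, $R\subseteq V$ a set of landmarks and $H=(R,\delta_H)$ the highway. For any two different labelling orders of $R$ (orders in which Algorithm 1 processes the landmarks), the labellings $L_1$ and $L_2$ constructed by Algorithm 1 (described in the context) using these two orders satisfy $L_1(v)=L_2(v)$ for every $v\in V\setminus R$.
   Context: $d_G(u,v)$ denotes the shortest-path distance in $G$. A highway is a pair $H=(R,\delta_H)$ with $\delta_H(r_1,r_2)=d_G(r_1,r_2)$ for all $r_1,r_2\in R$. A distance labelling assigns to each $v\in V\setminus R$ a label $L(v)$, a set of entries $(r,\delta_L(r,v))$ with $r\in R$ and $\delta_L(r,v)=d_G(r,v)$. Algorithm 1 (with a given order of $R$): initialise $L(v)=\emptyset$ for all $v\in V\setminus R$. For each $r_i\in R$, in the given order, run the following pruned BFS, in which each vertex is visited at most once and the root $r_i$ is visited at depth $0$. Keep two queues $\mathcal{Q}_{label}=\{r_i\}$ and $\mathcal{Q}_{prune}=\emptyset$ and set $n=0$. While $\mathcal{Q}_{label}$ contains vertices of depth $n$: (i) for each $u\in\mathcal{Q}_{label}$ at depth $n$ and each unvisited neighbour $v$ of $u$ (which becomes visited at depth $n+1$): if $v\in R$, enqueue $v$ to $\mathcal{Q}_{prune}$; otherwise enqueue $v$ to $\mathcal{Q}_{label}$ and add $(r_i,n+1)$ to $L(v)$; (ii) set $n\gets n+1$; (iii) for each $v\in\mathcal{Q}_{prune}$ at depth $n$, mark every unvisited neighbour of $v$ as visited at depth $n+1$ and enqueue it to $\mathcal{Q}_{prune}$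 (no label is added). The output is $L$. -}

module Defs where

open import Data.Nat using (ℕ; zero; suc)
open import Data.Fin using (Fin; _≟_)
open import Data.Bool using (Bool; true; false; if_then_else_; not; _∧_)
open import Data.List using (List; []; _∷_; _++_; _∷ʳ_; allFin)
open import Data.Product using (_×_; _,_)
open import Relation.Nullary.Decidable using (⌊_⌋)
open import Relation.Binary.PropositionalEquality using (_≡_)

record Graph (n : ℕ) : Set where
  field
    adj    : Fin n → Fin n → Bool
    sym    : ∀ u v → adj u v ≡ adj v u
    irrefl : ∀ v → adj v v ≡ false
open Graph public

data Reach {n : ℕ} (G : Graph n) : Fin n → Fin n → Set where
  here : ∀ {u} → Reach G u u
  step : ∀ {u w v} → adj G u w ≡ true → Reach G w v → Reach G u v

Connected : {n : ℕ} → Graph n → Set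
Connected G = ∀ u v → Reach G u v

Landmarks : ℕ → Set
Landmarks n = Fin n → Bool

open import Data.List.Relation.Unary.Unique.Propositional using (Unique)
open import Data.List.Membership.Propositional using (_∈_)
open import Function.Bundles using (_⇔_)

IsOrderOf : {n : ℕ} → Landmarks n → List (Fin n) → Set
IsOrderOf {n} R os = Unique os × (∀ (r : Fin n) → (r ∈ os) ⇔ (R r ≡ true))

-- A label: list of entries (r , δ_L(r,v)).  A labelling: a label per vertex.
Label : ℕ → Set
Label n = List (Fin n × ℕ)

Labelling : ℕ → Set
Labelling n = Fin n → Label n

module _ {n : ℕ} (G : Graph n) (R : Landmarks n) where

  mark : (Fin n → Bool) → Fin n → (Fin n → Bool)
  mark vis v x = if ⌊ x ≟ v ⌋ then true else vis x

  -- state of step (i): visited, new label-queue vertices, new prune-queue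
  -- vertices, produced (vertex , depth) label entries
  record StI : Set where
    constructor stI
    field
      vis  : Fin n → Bool
      newL : List (Fin n)
      newP : List (Fin n)
      labs : List (Fin n × ℕ)

  -- step (i) for one vertex u of Q_label, scanning its neighbours;
  -- d is the new depth n+1
  scanLabel : ℕ → Fin n → List (Fin n) → StI → StI
  scanLabel d u [] s = s
  scanLabel d u (v ∷ vs) (stI vis nl np lb) =
    scanLabel d u vs
      (if adj G u v ∧ not (vis v)
       then (if R v then stI (mark vis v) nl (np ∷ʳ v) lb
                    else stI (mark vis v) (nl ∷ʳ v) np (lb ∷ʳ (v , d)))
       else stI vis nl np lb)

  stepI : ℕ → List (Fin n) → StI → StI
  stepI d [] s = s
  stepI d (u ∷ us) s = stepI d us (scanLabel d u (allFin n) s)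

  -- step (iii): expand prune-queue vertices, marking unvisited neighbours
  scanPrune : Fin n → List (Fin n) → (Fin n → Bool) × List (Fin n)
            → (Fin n → Bool) × List (Fin n)
  scanPrune p [] s = s
  scanPrune p (w ∷ ws) (vis , q) =
    scanPrune p ws
      (if adj G p w ∧ not (vis w) then (mark vis w , q ∷ʳ w) else (vis , q))

  stepIII : List (Fin n) → (Fin n → Bool) × List (Fin n)
          → (Fin n → Bool) × List (Fin n)
  stepIII [] s = s
  stepIII (p ∷ ps) s = stepIII ps (scanPrune p (allFin n) s)

  -- Arguments: fuel, current depth d, visited set,
  -- Q_label vertices at depth d, Q_prune vertices at depth d+1 not yet
  -- expanded, accumulated label entries.  Fuel n suffices (each iteration
  -- consumes a nonempty set of freshly visited vertices).
  loop : ℕ → ℕ → (Fin n → Bool) → List (Fin n) → List (Fin n)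
       → List (Fin n × ℕ) → List (Fin n × ℕ)
  loop zero d vis lq pq acc = acc
  loop (suc f) d vis [] pq acc = acc
  loop (suc f) d vis (u ∷ us) pq acc with stepI (suc d) (u ∷ us) (stI vis [] [] [])
  ... | stI vis₁ nl np lb with stepIII (pq ++ np) (vis₁ , [])
  ...   | (vis₂ , pq₂) = loop f (suc d) vis₂ nl pq₂ (acc ++ lb)

  prunedBFS : Fin n → List (Fin n × ℕ)
  prunedBFS r = loop (suc n) 0 (mark (λ _ → false) r) (r ∷ []) [] []

  addEntries : Fin n → List (Fin n × ℕ) → Labelling n → Labelling n
  addEntries r [] L = L
  addEntries r ((v , d) ∷ es) L =
    addEntries r es (λ x → if ⌊ x ≟ v ⌋ then L x ∷ʳ (r , d) else L x)

  algo : List (Fin n) → Labelling n → Labelling n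
  algo [] L = L
  algo (r ∷ rs) L = algo rs (addEntries r (prunedBFS r) L)

  algorithm1 : List (Fin n) → Labelling n
  algorithm1 os = algo os (λ _ → [])

module Submission where

-- The key observation is that in the definition of Algorithm 1 the pruned
-- BFS rooted at a landmark r (prunedBFS G R r) is a function of G, R and r
-- alone: every search starts from a fresh visited set, and the other
-- landmarks influence it only through the fixed predicate R (they prune),
-- never through the labels computed so far.  Running the outer loop over
-- a list of roots therefore merely appends, for each root r, the entries
-- (r , d) for all (v , d) reported by the search from r.
--
-- We make this precise by characterising label membership: first for one
-- appended entry (∈-appendAt), then for all entries of one search
-- (∈-addEntries), then for the whole outer loop (∈-algo, ∈-algorithm1):
--   (x , d) ∈ algorithm1 os v  ⇔  x ∈ os  and  (v , d) ∈ prunedBFS x.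
-- The right-hand side depends on os only through its set of elements, and
-- any two labelling orders of R have the same elements, namely R; this
-- gives the theorem (labels being compared as sets of entries).

open import Defs
open import Data.Nat using (ℕ)
open import Data.Fin using (Fin; _≟_)
open import Data.Bool using (true; if_then_else_)
open import Data.List using (List; []; _∷_; _∷ʳ_)
open import Data.List.Relation.Unary.Any using (here; there)
open import Data.List.Membership.Propositional using (_∈_)
open import Data.List.Membership.Propositional.Properties using (∈-++⁺ˡ; ∈-++⁺ʳ; ∈-++⁻)
open import Data.Product using (_×_; _,_)
open import Data.Product.Function.NonDependent.Propositional using (_×-⇔_)
open import Data.Sum using (_⊎_; inj₁; inj₂)
open import Function.Bundles using (_⇔_; mk⇔; Equivalence)
open import Function.Construct.Identity using (⇔-id)
open import Function.Construct.Symmetry using (⇔-sym)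
open import Function.Construct.Composition using (_⇔-∘_)
open import Relation.Nullary using (yes; no; contradiction)
open import Relation.Nullary.Decidable using (⌊_⌋)
open import Relation.Binary.PropositionalEquality using (_≡_; _≢_; refl)

open Equivalence using (to; from)

∈-appendAt : ∀ {n} {A : Set} (L : Fin n → List A) (u : Fin n) (e : A) (y : Fin n) (a : A)
  → a ∈ (if ⌊ y ≟ u ⌋ then L y ∷ʳ e else L y) ⇔ (a ∈ L y ⊎ (y ≡ u × a ≡ e))
∈-appendAt L u e y a with y ≟ u
... | no y≢u = mk⇔ inj₁ λ { (inj₁ a∈L) → a∈L ; (inj₂ (y≡u , _)) → contradiction y≡u y≢u }
... | yes refl = mk⇔ appended unappended
  where
    appended : a ∈ L y ∷ʳ e → a ∈ L y ⊎ (y ≡ y × a ≡ e)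
    appended a∈ with ∈-++⁻ (L y) a∈
    ... | inj₁ a∈L = inj₁ a∈L
    ... | inj₂ (here a≡e) = inj₂ (refl , a≡e)

    unappended : a ∈ L y ⊎ (y ≡ y × a ≡ e) → a ∈ L y ∷ʳ e
    unappended (inj₁ a∈L) = ∈-++⁺ˡ a∈L
    unappended (inj₂ (_ , a≡e)) = ∈-++⁺ʳ (L y) (here a≡e)

orders-sameElements : ∀ {n} {R : Landmarks n} {o₁ o₂ : List (Fin n)}
  → IsOrderOf R o₁ → IsOrderOf R o₂ → ∀ y → y ∈ o₁ ⇔ y ∈ o₂
orders-sameElements (_ , enum₁) (_ , enum₂) y = ⇔-sym (enum₂ y) ⇔-∘ enum₁ y

module _ {n : ℕ} (G : Graph n) (R : Landmarks n) where

  ∈-addEntries : ∀ r es (L : Labelling n) v x d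
    → (x , d) ∈ addEntries G R r es L v ⇔ ((x , d) ∈ L v ⊎ (x ≡ r × (v , d) ∈ es))
  ∈-addEntries r [] L v x d = mk⇔ inj₁ λ { (inj₁ e∈L) → e∈L ; (inj₂ (_ , ())) }
  ∈-addEntries r ((u , d′) ∷ es) L v x d = mk⇔ added unadded
    where
      L′ : Labelling n
      L′ y = if ⌊ y ≟ u ⌋ then L y ∷ʳ (r , d′) else L y

      rest : (x , d) ∈ addEntries G R r es L′ v ⇔ ((x , d) ∈ L′ v ⊎ (x ≡ r × (v , d) ∈ es))
      rest = ∈-addEntries r es L′ v x d

      first : (x , d) ∈ L′ v ⇔ ((x , d) ∈ L v ⊎ (v ≡ u × (x , d) ≡ (r , d′)))
      first = ∈-appendAt L u (r , d′) v (x , d)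

      added : (x , d) ∈ addEntries G R r es L′ v
            → (x , d) ∈ L v ⊎ (x ≡ r × (v , d) ∈ (u , d′) ∷ es)
      added e∈ with to rest e∈
      ... | inj₂ (x≡r , v∈es) = inj₂ (x≡r , there v∈es)
      ... | inj₁ e∈L′ with to first e∈L′
      ...   | inj₁ e∈L = inj₁ e∈L
      ...   | inj₂ (refl , refl) = inj₂ (refl , here refl)

      unadded : (x , d) ∈ L v ⊎ (x ≡ r × (v , d) ∈ (u , d′) ∷ es)
              → (x , d) ∈ addEntries G R r es L′ v
      unadded (inj₁ e∈L) = from rest (inj₁ (from first (inj₁ e∈L)))
      unadded (inj₂ (refl , here refl)) = from rest (inj₁ (from first (inj₂ (refl , refl))))
      unadded (inj₂ (x≡r , there v∈es)) = from rest (inj₂ (x≡r , v∈es))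

  ∈-algo : ∀ os (L : Labelling n) v x d
    → (x , d) ∈ algo G R os L v ⇔ ((x , d) ∈ L v ⊎ (x ∈ os × (v , d) ∈ prunedBFS G R x))
  ∈-algo [] L v x d = mk⇔ inj₁ λ { (inj₁ e∈L) → e∈L ; (inj₂ (() , _)) }
  ∈-algo (r ∷ rs) L v x d = mk⇔ added unadded
    where
      L′ : Labelling n
      L′ = addEntries G R r (prunedBFS G R r) L

      rest : (x , d) ∈ algo G R rs L′ v ⇔ ((x , d) ∈ L′ v ⊎ (x ∈ rs × (v , d) ∈ prunedBFS G R x))
      rest = ∈-algo rs L′ v x d

      first : (x , d) ∈ L′ v ⇔ ((x , d) ∈ L v ⊎ (x ≡ r × (v , d) ∈ prunedBFS G R r))
      first = ∈-addEntries r (prunedBFS G R r) L v x d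

      added : (x , d) ∈ algo G R rs L′ v
            → (x , d) ∈ L v ⊎ (x ∈ r ∷ rs × (v , d) ∈ prunedBFS G R x)
      added e∈ with to rest e∈
      ... | inj₂ (x∈rs , reached) = inj₂ (there x∈rs , reached)
      ... | inj₁ e∈L′ with to first e∈L′
      ...   | inj₁ e∈L = inj₁ e∈L
      ...   | inj₂ (refl , reached) = inj₂ (here refl , reached)

      unadded : (x , d) ∈ L v ⊎ (x ∈ r ∷ rs × (v , d) ∈ prunedBFS G R x)
              → (x , d) ∈ algo G R rs L′ v
      unadded (inj₁ e∈L) = from rest (inj₁ (from first (inj₁ e∈L)))
      unadded (inj₂ (here refl , reached)) = from rest (inj₁ (from first (inj₂ (refl , reached))))
      unadded (inj₂ (there x∈rs , reached)) = from rest (inj₂ (x∈rs , reached))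

  ∈-algorithm1 : ∀ os v x d
    → (x , d) ∈ algorithm1 G R os v ⇔ (x ∈ os × (v , d) ∈ prunedBFS G R x)
  ∈-algorithm1 os v x d = mk⇔ fromRoots (λ rooted → from (∈-algo os _ v x d) (inj₂ rooted))
    where
      fromRoots : (x , d) ∈ algorithm1 G R os v → x ∈ os × (v , d) ∈ prunedBFS G R x
      fromRoots e∈ with to (∈-algo os _ v x d) e∈
      ... | inj₂ rooted = rooted

  algorithm1-sameElements : ∀ o₁ o₂ → (∀ y → y ∈ o₁ ⇔ y ∈ o₂)
    → ∀ v e → e ∈ algorithm1 G R o₁ v ⇔ e ∈ algorithm1 G R o₂ v
  algorithm1-sameElements o₁ o₂ same v (x , d) =
    ⇔-sym (∈-algorithm1 o₂ v x d) ⇔-∘ ((same x ×-⇔ ⇔-id _) ⇔-∘ ∈-algorithm1 o₁ v x d)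

lemma3p11 : (n : ℕ) (G : Graph n) → Connected G → (R : Landmarks n)
    → (o₁ o₂ : List (Fin n)) → IsOrderOf R o₁ → IsOrderOf R o₂ → o₁ ≢ o₂
    → ∀ (v : Fin n) → R v ≢ true
    → ∀ (e : Fin n × ℕ) → (e ∈ algorithm1 G R o₁ v) ⇔ (e ∈ algorithm1 G R o₂ v)
lemma3p11 n G _ R o₁ o₂ order₁ order₂ _ v _ =
  algorithm1-sameElements G R o₁ o₂ (orders-sameElements order₁ order₂) v
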